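{- For every integer $k\geq 2$ and every nonnegative integer $n$, there is a bijection between $R_k(n)$ and $Q_{2k-2}(n)$ (in particular $|R_k(n)|=|Q_{2k-2}(n)|$).
   Context: An anti-lecture hall composition of $n$ is an infinite sequence $\mu=(\mu_1,\mu_2,\ldots)$ of nonnegative integers, only finitely many nonzero, with $\sum_i\mu_i=n$ and $\frac{\mu_1}{1}\geq\frac{\mu_2}{2}\geq\cdots\geq 0$. $Q_m(n)$ is the set of anti-lecture hall compositions $\mu$ of $n$ such that $\lfloor \mu_i/i\rfloor$ is even for every $i\geq1$ and $\mu_1\leq m$. For a partition $\lambda=(\lambda_1\geq\lambda_2\geq\cdots\geq\lambda_\ell>0)$, its $N\times(N+1)$ Durfee rectangle is the rectangle of $N$ rows and $N+1$ columns in the upper-left corner of its Ferrers diagram, where $N$ is the largest integer with $\lambda_N\geq N+1$ (and $N=0$ if $\lambda_1\le 1$ or $\lambda$ is empty). Successive Durfee rectangles are obtained by taking the Durfee rectangle of $\lambda$, then the Durfee rectangle of the partition formed by the parts below it (i.e. $(\lambda_{N+1},\ldots,\lambda_\ell)$), and so on. $R_k(n)$ is the set of partitions of $n$ with every part greater than $1$ that have at most $k-1$ (nonempty) successive $N\times(N+1)$ Durfee rectangles such that there is no part below the last Durfee rectangle. -}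

module Defs where

open import Data.Nat using (ℕ; zero; suc; _+_; _*_; _∸_; _≤_; _≥_; _≤?_)
open import Data.Nat.ListAction using (sum)
open import Relation.Nullary using (yes; no)
open import Relation.Binary.PropositionalEquality using (_≡_)
open import Data.Nat.DivMod using (_/_)
open import Data.Nat.Divisibility using (_∣_)
open import Data.List using (List; []; _∷_; drop)
open import Data.List.Relation.Unary.All using (All)
open import Data.List.Relation.Unary.Linked using (Linked)
open import Data.Product using (Σ; _×_)
open import Data.Unit using (⊤)

IsPartition : ℕ → List ℕ → Set
IsPartition n λs = Linked _≥_ λs × All (λ x → 1 ≤ x) λs × sum λs ≡ n

-- Side N of the N × (N+1) Durfee rectangle of a (weakly decreasing) list:
-- the largest N with λ_N ≥ N+1 (0 if none).  For a weakly decreasing list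
-- the indices i with λ_i ≥ i+1 form an initial segment, so N is the length
-- of that segment.  'durfeeFrom i xs' treats the head of xs as λ_i.
durfeeFrom : ℕ → List ℕ → ℕ
durfeeFrom i [] = 0
durfeeFrom i (x ∷ xs) with suc i ≤? x
... | yes _ = suc (durfeeFrom (suc i) xs)
... | no _  = 0

durfee : List ℕ → ℕ
durfee = durfeeFrom 1

-- FitsIn j λ : λ has at most j nonempty successive N×(N+1) Durfee
-- rectangles, with no part below the last one.
data FitsIn : ℕ → List ℕ → Set where
  done : ∀ {j} → FitsIn j []
  step : ∀ {j} (xs : List ℕ) → 1 ≤ durfee xs →
         FitsIn j (drop (durfee xs) xs) → FitsIn (suc j) xs

R : ℕ → ℕ → Set
R k n = Σ (List ℕ) λ λs →
  IsPartition n λs × All (λ x → 2 ≤ x) λs × FitsIn (k ∸ 1) λs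

-- The infinite sequence (μ_1, μ_2, …)
-- with finitely many nonzero terms is represented canonically by the
-- finite list (μ_1, …, μ_L) with μ_L ≠ 0 (all later terms being 0).

data LastNonZero : List ℕ → Set where
  nil  : LastNonZero []
  one  : ∀ {x} → 1 ≤ x → LastNonZero (x ∷ [])
  cons : ∀ {x y ys} → LastNonZero (y ∷ ys) → LastNonZero (x ∷ y ∷ ys)

-- μ_i / i ≥ μ_{i+1} / (i+1), i.e. (i+1) μ_i ≥ i μ_{i+1}; the head of the
-- list is μ_i.  (Comparisons with the trailing zeros are automatic.)
ALHFrom : ℕ → List ℕ → Set
ALHFrom i []           = ⊤
ALHFrom i (x ∷ [])     = ⊤
ALHFrom i (x ∷ y ∷ ys) = i * y ≤ suc i * x × ALHFrom (suc i) (y ∷ ys)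

-- ⌊μ_i / i⌋ is even; here the head of the list is μ_{suc i}.
-- (For the trailing zeros ⌊0/i⌋ = 0 is even automatically.)
EvenFloorFrom : ℕ → List ℕ → Set
EvenFloorFrom i []       = ⊤
EvenFloorFrom i (x ∷ xs) = 2 ∣ (x / suc i) × EvenFloorFrom (suc i) xs

-- μ_1 ≤ m (vacuous for the zero sequence, μ_1 = 0).
FirstAtMost : ℕ → List ℕ → Set
FirstAtMost m []      = ⊤
FirstAtMost m (x ∷ _) = x ≤ m

Q : ℕ → ℕ → Set
Q m n = Σ (List ℕ) λ μ →
  LastNonZero μ × sum μ ≡ n × ALHFrom 1 μ × EvenFloorFrom 0 μ × FirstAtMost m μ

module Submission where

-- Both sides are put in bijection with one intermediate family, the
-- chains of Durfee blocks.  A block (L , e) is an L × (L+1) rectangle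
-- together with a partition e with exactly L parts (zero parts allowed);
-- a chain (L₁ , e₁) (L₂ , e₂) … has L₁ ≥ L₂ ≥ … ≥ 1, and for t ≥ 2 the
-- parts of e_t are at most L_{t-1} - L_t.  Its weight is Σ L_t (L_t+1) + |e_t|.
--
-- * Partitions.  Block (L , e) contributes the rows L+1+e_1, …, L+1+e_L:
--   its rectangle is exactly the Durfee rectangle of what remains, and the
--   bound on e_t says that these rows fit below the previous rectangle.
--   Parsing reads off successive Durfee rectangles.
-- * Anti-lecture hall compositions.  A chain is built from its last block
--   upwards: on top of a composition μ' of length L, block (L , e) yields
--   (μ'_i + 2i)_{i ≤ L} followed by the conjugate of e.  The shift by 2i
--   keeps ⌊μ_i / i⌋ even and adds L (L+1) to the weight; the conjugate is a
--   small tail (μ_i < i there), which is where the anti-lecture hall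
--   condition forces a partition.  Parsing splits μ at the first i with
--   μ_i < 2i.  Each block raises the bound on μ_1 by 2, so at most k-1
--   blocks corresponds to μ_1 ≤ 2k-2.
--
-- Every correspondence is a pair of mutually inverse maps on the
-- underlying lists, preserving proof-irrelevant validity predicates; a
-- generic lemma turns such a pair into a bijection of the subtypes.

open import Defs
open import Data.Nat using (ℕ; zero; suc; _+_; _*_; _∸_; _≤_; _<_; _≥_; _≤?_; z≤n; s≤s)
open import Data.Nat.Properties
open import Data.Nat.DivMod using (_/_; m*n/n≡m; +-distrib-/-∣ˡ; m<n⇒m/n≡0; m<n*o⇒m/o<n; /-monoˡ-≤; n/n≡1)
open import Data.Nat.Divisibility using (_∣_; divides; ∣m+n∣m⇒∣n; ∣m∣n⇒∣m+n; ∣-refl; ∣1⇒≡1)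
open import Data.Nat.Tactic.RingSolver using (solve-∀)
open import Data.Nat.ListAction using (sum)
open import Data.Nat.ListAction.Properties using (sum-++)
open import Data.List using (List; []; _∷_; _++_; map; take; drop; length; replicate)
open import Data.List.Properties using (length-map; length-take; length-++; length-replicate; take++drop≡id)
open import Data.List.Relation.Unary.All as All using (All; []; _∷_)
open import Data.List.Relation.Unary.All.Properties using (++⁺; ++⁻ʳ; take⁺; map⁺; replicate⁺)
open import Data.List.Relation.Unary.Linked as Linked using (Linked; []; [-]; _∷_)
import Data.List.Relation.Unary.Linked.Properties as Linked
open import Data.Product using (Σ; _×_; _,_; proj₁; proj₂)
open import Data.Unit using (⊤; tt)
open import Data.Unit.Properties using (⊤-irrelevant)
open import Data.Empty using (⊥; ⊥-elim)
open import Relation.Binary.PropositionalEquality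
open import Relation.Nullary using (yes; no; ¬_)
open import Relation.Nullary.Irrelevant using (Irrelevant)
open import Function.Bundles using (_⤖_; _↔_; mk↔ₛ′)
open import Function.Properties.Inverse using (↔-trans; ↔-sym; ↔⇒⤖)

Decreasing : List ℕ → Set
Decreasing = Linked _≥_

decreasing⇒≤head : ∀ {x xs} → Decreasing (x ∷ xs) → All (_≤ x) xs
decreasing⇒≤head [-] = []
decreasing⇒≤head (p ∷ d) = p ∷ All.map (λ q → ≤-trans q p) (decreasing⇒≤head d)

decreasing-++ : ∀ {c xs ys} → Decreasing xs → Decreasing ys →
  All (c ≤_) xs → All (_≤ c) ys → Decreasing (xs ++ ys)
decreasing-++ [] dys _ _ = dys
decreasing-++ [-] [] _ _ = [-]
decreasing-++ [-] dys (cx ∷ _) (yc ∷ _) = ≤-trans yc cx ∷ dys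
decreasing-++ (p ∷ dxs) dys (_ ∷ cxs) ycs = p ∷ decreasing-++ dxs dys cxs ycs

decreasing-map : ∀ (f : ℕ → ℕ) → (∀ {a b} → a ≤ b → f a ≤ f b) →
  ∀ {xs} → Decreasing xs → Decreasing (map f xs)
decreasing-map f mono d = Linked.map⁺ (Linked.map mono d)

decreasing-take : ∀ n {xs} → Decreasing xs → Decreasing (take n xs)
decreasing-take zero d = []
decreasing-take (suc n) [] = []
decreasing-take (suc zero) [-] = [-]
decreasing-take (suc (suc n)) [-] = [-]
decreasing-take (suc zero) (p ∷ d) = [-]
decreasing-take (suc (suc n)) (p ∷ d) = p ∷ decreasing-take (suc n) d

decreasing-drop : ∀ n {xs} → Decreasing xs → Decreasing (drop n xs)
decreasing-drop zero d = d
decreasing-drop (suc n) {[]} d = []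
decreasing-drop (suc n) {x ∷ xs} d = decreasing-drop n (Linked.tail d)

-- A block (L , e): an L × (L+1) rectangle and a partition e with L parts.
Block : Set
Block = ℕ × List ℕ

BoundedChain : ℕ → ℕ → List Block → Set
BoundedChain j B [] = ⊤
BoundedChain zero B (_ ∷ _) = ⊥
BoundedChain (suc j) B ((L , e) ∷ bs) =
  1 ≤ L × L ≤ B × length e ≡ L × Decreasing e × All (_≤ B ∸ L) e × BoundedChain j L bs

-- Chain j bs: at most j+1 blocks, the first one of arbitrary size.
Chain : ℕ → List Block → Set
Chain j [] = ⊤
Chain j ((L , e) ∷ bs) = 1 ≤ L × length e ≡ L × Decreasing e × BoundedChain j L bs

weight : List Block → ℕ
weight [] = 0
weight ((L , e) ∷ bs) = L * suc L + sum e + weight bs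

-- The only part of validity needed to compute weights: every block
-- (L , e) has L parts.
ChainLengths : List Block → Set
ChainLengths = All (λ b → length (proj₂ b) ≡ proj₁ b)

boundedChain-lengths : ∀ j B bs → BoundedChain j B bs → ChainLengths bs
boundedChain-lengths j B [] _ = []
boundedChain-lengths (suc j) B ((L , e) ∷ bs) (_ , _ , len , _ , _ , c) =
  len ∷ boundedChain-lengths j L bs c

chain-lengths : ∀ j bs → Chain j bs → ChainLengths bs
chain-lengths j [] _ = []
chain-lengths j ((L , e) ∷ bs) (_ , len , _ , c) = len ∷ boundedChain-lengths j L bs c

rows : ℕ → List ℕ → List ℕ
rows L e = map (suc L +_) e

toPartition : List Block → List ℕ
toPartition [] = []
toPartition ((L , e) ∷ bs) = rows L e ++ toPartition bs

durfeeBlocks : ℕ → List ℕ → List Block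
durfeeBlocks zero xs = []
durfeeBlocks (suc j) [] = []
durfeeBlocks (suc j) (x ∷ xs) =
  (N , map (_∸ suc N) (take N (x ∷ xs))) ∷ durfeeBlocks j (drop N (x ∷ xs))
  where N = durfee (x ∷ xs)

durfeeBlocks-unfold : ∀ j x xs N → durfee (x ∷ xs) ≡ N →
  durfeeBlocks (suc j) (x ∷ xs) ≡ (N , map (_∸ suc N) (take N (x ∷ xs))) ∷ durfeeBlocks j (drop N (x ∷ xs))
durfeeBlocks-unfold j x xs .(durfee (x ∷ xs)) refl = refl

-- Below the rows of a block (L , e) only parts ≤ L+1: the Durfee side is
-- the number of rows (stated for the counter durfeeFrom i, i + |e| = L+1).
durfee-rows : ∀ i L e rest → i + length e ≡ suc L → All (_≤ suc L) rest →
  durfeeFrom i (rows L e ++ rest) ≡ length e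
durfee-rows i L [] [] eq a = refl
durfee-rows i L [] (y ∷ rest) eq (y≤L ∷ a) with suc i ≤? y
... | yes p = ⊥-elim (<-irrefl refl (≤-trans p (≤-trans y≤L (≤-reflexive (trans (sym eq) (+-identityʳ i))))))
... | no _ = refl
durfee-rows i L (x ∷ e) rest eq a with suc i ≤? suc L + x
... | yes _ = cong suc (durfee-rows (suc i) L e rest (trans (sym (+-suc i (length e))) eq) a)
... | no i≰ = ⊥-elim (i≰ (s≤s (≤-trans (m≤m+n i (length e))
                  (≤-trans (≤-reflexive (suc-injective (trans (sym (+-suc i (length e))) eq))) (m≤m+n L x)))))

durfeeFrom≤length : ∀ i xs → durfeeFrom i xs ≤ length xs
durfeeFrom≤length i [] = z≤n
durfeeFrom≤length i (x ∷ xs) with suc i ≤? x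
... | yes _ = s≤s (durfeeFrom≤length (suc i) xs)
... | no _ = z≤n

durfee-rows-long : ∀ i xs → Decreasing xs →
  All (λ x → i + durfeeFrom i xs ≤ x) (take (durfeeFrom i xs) xs)
durfee-rows-long i [] d = []
durfee-rows-long i (x ∷ xs) d with suc i ≤? x
... | no _ = []
... | yes p = head-long xs (durfeeFrom (suc i) xs) d (durfeeFrom≤length (suc i) xs) ih
              ∷ All.map (≤-trans (≤-reflexive (+-suc i _))) ih
  where
  ih = durfee-rows-long (suc i) xs (Linked.tail d)
  head-long : ∀ xs N → Decreasing (x ∷ xs) → N ≤ length xs →
    All (λ z → suc i + N ≤ z) (take N xs) → i + suc N ≤ x
  head-long xs zero _ _ _ = ≤-trans (≤-reflexive (+-comm i 1)) p
  head-long (y ∷ ys) (suc N) (x≥y ∷ _) _ (q ∷ _) = ≤-trans (≤-reflexive (+-suc i (suc N))) (≤-trans q x≥y)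

durfee-below-short : ∀ i xs → Decreasing xs →
  All (_≤ i + durfeeFrom i xs) (drop (durfeeFrom i xs) xs)
durfee-below-short i [] d = []
durfee-below-short i (x ∷ xs) d with suc i ≤? x
... | yes p = All.map (λ q → ≤-trans q (≤-reflexive (sym (+-suc i _)))) (durfee-below-short (suc i) xs (Linked.tail d))
... | no i≰x = x≤i ∷ All.map (λ q → ≤-trans q x≤i) (decreasing⇒≤head d)
  where
  x≤i : x ≤ i + 0
  x≤i = ≤-trans (≤-pred (≰⇒> i≰x)) (≤-reflexive (sym (+-identityʳ i)))

rows-long : ∀ L e → All (suc L ≤_) (rows L e)
rows-long L [] = []
rows-long L (x ∷ e) = m≤m+n (suc L) x ∷ rows-long L e

head-of-take : ∀ {P : ℕ → Set} N x xs → 1 ≤ N → All P (take N (x ∷ xs)) → P x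
head-of-take (suc N) x xs _ (p ∷ _) = p

drop-rows : ∀ L e rest → drop (length e) (rows L e ++ rest) ≡ rest
drop-rows L [] rest = refl
drop-rows L (x ∷ e) rest = drop-rows L e rest

take-rows : ∀ L e rest → take (length e) (rows L e ++ rest) ≡ rows L e
take-rows L [] rest = refl
take-rows L (x ∷ e) rest = cong (_ ∷_) (take-rows L e rest)

unrows-rows : ∀ L e → map (_∸ suc L) (rows L e) ≡ e
unrows-rows L [] = refl
unrows-rows L (x ∷ e) = cong₂ _∷_ (m+n∸m≡n (suc L) x) (unrows-rows L e)

rows-unrows : ∀ L ys → All (suc L ≤_) ys → rows L (map (_∸ suc L) ys) ≡ ys
rows-unrows L [] [] = refl
rows-unrows L (y ∷ ys) (p ∷ a) = cong₂ _∷_ (m+[n∸m]≡n p) (rows-unrows L ys a)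

sum-rows : ∀ L e → sum (rows L e) ≡ length e * suc L + sum e
sum-rows L [] = refl
sum-rows L (x ∷ e) = trans (cong (suc L + x +_) (sum-rows L e)) (rearrange (suc L) x (length e * suc L) (sum e))
  where
  rearrange : ∀ a b c d → a + b + (c + d) ≡ a + c + (b + d)
  rearrange = solve-∀

prepend-block : ∀ j L e rest → 1 ≤ L → length e ≡ L → Decreasing e →
  Decreasing rest → FitsIn j rest → All (_≤ suc L) rest → All (2 ≤_) rest →
  Decreasing (rows L e ++ rest) × FitsIn (suc j) (rows L e ++ rest) × All (2 ≤_) (rows L e ++ rest)
prepend-block j L e rest 1≤L len de drest frest short big =
  decreasing-++ {c = suc L} (decreasing-map (suc L +_) (+-monoʳ-≤ (suc L)) de) drest (rows-long L e) short ,
  step _ (subst (1 ≤_) (sym side) 1≤L)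
       (subst (λ N → FitsIn j (drop N (rows L e ++ rest))) (sym side′)
              (subst (FitsIn j) (sym (drop-rows L e rest)) frest)) ,
  ++⁺ (All.map (≤-trans (s≤s 1≤L)) (rows-long L e)) big
  where
  side′ : durfee (rows L e ++ rest) ≡ length e
  side′ = durfee-rows 1 L e rest (cong suc len) short
  side : durfee (rows L e ++ rest) ≡ L
  side = trans side′ len

boundedChain⇒partition : ∀ j B bs → BoundedChain j B bs →
  Decreasing (toPartition bs) × FitsIn j (toPartition bs) ×
  All (_≤ suc B) (toPartition bs) × All (2 ≤_) (toPartition bs)
boundedChain⇒partition j B [] _ = [] , done , [] , []
boundedChain⇒partition (suc j) B ((L , e) ∷ bs) (1≤L , L≤B , len , de , e≤ , c)
  with boundedChain⇒partition j L bs c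
... | drest , frest , short , big with prepend-block j L e (toPartition bs) 1≤L len de drest frest short big
... | d , f , b = d , f , ++⁺ (rows-short e e≤) (All.map (λ q → ≤-trans q (s≤s L≤B)) short) , b
  where
  rows-short : ∀ e → All (_≤ B ∸ L) e → All (_≤ suc B) (rows L e)
  rows-short [] [] = []
  rows-short (x ∷ e) (p ∷ a) = ≤-trans (+-monoʳ-≤ (suc L) p) (≤-reflexive (cong suc (m+[n∸m]≡n L≤B))) ∷ rows-short e a

chain⇒partition : ∀ j bs → Chain j bs →
  Decreasing (toPartition bs) × FitsIn (suc j) (toPartition bs) × All (2 ≤_) (toPartition bs)
chain⇒partition j [] _ = [] , done , []
chain⇒partition j ((L , e) ∷ bs) (1≤L , len , de , c) with boundedChain⇒partition j L bs c
... | drest , frest , short , big = prepend-block j L e (toPartition bs) 1≤L len de drest frest short big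

sum-toPartition : ∀ bs → ChainLengths bs → sum (toPartition bs) ≡ weight bs
sum-toPartition [] _ = refl
sum-toPartition ((L , e) ∷ bs) (len ∷ lens) = begin
  sum (rows L e ++ toPartition bs)          ≡⟨ sum-++ (rows L e) (toPartition bs) ⟩
  sum (rows L e) + sum (toPartition bs)     ≡⟨ cong₂ _+_ (sum-rows L e) (sum-toPartition bs lens) ⟩
  length e * suc L + sum e + weight bs      ≡⟨ cong (λ n → n * suc L + sum e + weight bs) len ⟩
  L * suc L + sum e + weight bs ∎
  where open ≡-Reasoning

length-durfeeRows : ∀ xs → length (map (_∸ suc (durfee xs)) (take (durfee xs) xs)) ≡ durfee xs
length-durfeeRows xs = trans (length-map _ (take N xs)) (trans (length-take N xs) (m≤n⇒m⊓n≡m (durfeeFrom≤length 1 xs)))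
  where N = durfee xs

partition⇒boundedChain : ∀ j B xs → Decreasing xs → FitsIn j xs → All (_≤ suc B) xs →
  BoundedChain j B (durfeeBlocks j xs)
partition⇒boundedChain zero B xs d f a = tt
partition⇒boundedChain (suc j) B [] d f a = tt
partition⇒boundedChain (suc j) B (x ∷ xs) d (step _ p f) a =
  p ,
  ≤-pred (≤-trans (head-of-take N x xs p (durfee-rows-long 1 (x ∷ xs) d)) (head-of-take N x xs p (take⁺ N a))) ,
  length-durfeeRows (x ∷ xs) ,
  decreasing-map (_∸ suc N) (∸-monoˡ-≤ (suc N)) (decreasing-take N d) ,
  map⁺ (All.map (∸-monoˡ-≤ (suc N)) (take⁺ N a)) ,
  partition⇒boundedChain j N (drop N (x ∷ xs)) (decreasing-drop N d) f (durfee-below-short 1 (x ∷ xs) d)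
  where N = durfee (x ∷ xs)

partition⇒chain : ∀ j xs → Decreasing xs → FitsIn (suc j) xs → Chain j (durfeeBlocks (suc j) xs)
partition⇒chain j [] d f = tt
partition⇒chain j (x ∷ xs) d (step _ p f) =
  p ,
  length-durfeeRows (x ∷ xs) ,
  decreasing-map (_∸ suc N) (∸-monoˡ-≤ (suc N)) (decreasing-take N d) ,
  partition⇒boundedChain j N (drop N (x ∷ xs)) (decreasing-drop N d) f (durfee-below-short 1 (x ∷ xs) d)
  where N = durfee (x ∷ xs)

toPartition-durfeeBlocks : ∀ j xs → FitsIn j xs → Decreasing xs → toPartition (durfeeBlocks j xs) ≡ xs
toPartition-durfeeBlocks zero [] done d = refl
toPartition-durfeeBlocks (suc j) [] done d = refl
toPartition-durfeeBlocks (suc j) (x ∷ xs) (step _ p f) d = begin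
  rows N (map (_∸ suc N) (take N (x ∷ xs))) ++ toPartition (durfeeBlocks j (drop N (x ∷ xs)))
    ≡⟨ cong₂ _++_ (rows-unrows N (take N (x ∷ xs)) (durfee-rows-long 1 (x ∷ xs) d))
                  (toPartition-durfeeBlocks j (drop N (x ∷ xs)) f (decreasing-drop N d)) ⟩
  take N (x ∷ xs) ++ drop N (x ∷ xs)
    ≡⟨ take++drop≡id N (x ∷ xs) ⟩
  x ∷ xs ∎
  where
  N = durfee (x ∷ xs)
  open ≡-Reasoning

durfeeBlocks-prepend : ∀ j L e bs → 1 ≤ L → length e ≡ L → All (_≤ suc L) (toPartition bs) →
  durfeeBlocks (suc j) (toPartition ((L , e) ∷ bs)) ≡ (L , e) ∷ durfeeBlocks j (toPartition bs)
durfeeBlocks-prepend j .0 [] bs () refl short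
durfeeBlocks-prepend j L (y ∷ e) bs 1≤L len short =
  trans (durfeeBlocks-unfold j (suc L + y) (rows L e ++ toPartition bs) L side)
        (cong₂ _∷_ (cong (L ,_) (trans (cong (map (_∸ suc L)) taken) (unrows-rows L (y ∷ e))))
                   (cong (durfeeBlocks j) dropped))
  where
  side : durfee (rows L (y ∷ e) ++ toPartition bs) ≡ L
  side = trans (durfee-rows 1 L (y ∷ e) (toPartition bs) (cong suc len) short) len
  taken : take L (rows L (y ∷ e) ++ toPartition bs) ≡ rows L (y ∷ e)
  taken = subst (λ N → take N (rows L (y ∷ e) ++ toPartition bs) ≡ rows L (y ∷ e)) len (take-rows L (y ∷ e) (toPartition bs))
  dropped : drop L (rows L (y ∷ e) ++ toPartition bs) ≡ toPartition bs
  dropped = subst (λ N → drop N (rows L (y ∷ e) ++ toPartition bs) ≡ toPartition bs) len (drop-rows L (y ∷ e) (toPartition bs))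

durfeeBlocks-toPartition-bounded : ∀ j B bs → BoundedChain j B bs → durfeeBlocks j (toPartition bs) ≡ bs
durfeeBlocks-toPartition-bounded zero B [] _ = refl
durfeeBlocks-toPartition-bounded (suc j) B [] _ = refl
durfeeBlocks-toPartition-bounded (suc j) B ((L , e) ∷ bs) (1≤L , _ , len , _ , _ , c)
  with boundedChain⇒partition j L bs c
... | _ , _ , short , _ =
  trans (durfeeBlocks-prepend j L e bs 1≤L len short) (cong ((L , e) ∷_) (durfeeBlocks-toPartition-bounded j L bs c))

durfeeBlocks-toPartition : ∀ j bs → Chain j bs → durfeeBlocks (suc j) (toPartition bs) ≡ bs
durfeeBlocks-toPartition j [] _ = refl
durfeeBlocks-toPartition j ((L , e) ∷ bs) (1≤L , len , _ , c)
  with boundedChain⇒partition j L bs c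
... | _ , _ , short , _ =
  trans (durfeeBlocks-prepend j L e bs 1≤L len short) (cong ((L , e) ∷_) (durfeeBlocks-toPartition-bounded j L bs c))

-- Indices are 1-based: the
-- parity condition concerns ⌊x / (i+1)⌋, and the anti-lecture hall step
-- between μ_p = x and μ_{p+1} = y reads p y ≤ (p+1) x.

floor-shift : ∀ i x → (2 * suc i + x) / suc i ≡ 2 + x / suc i
floor-shift i x = trans (+-distrib-/-∣ˡ x {suc i} (divides 2 refl)) (cong (_+ x / suc i) (m*n/n≡m 2 (suc i)))

even-floor-shift : ∀ i x → 2 ∣ x / suc i → 2 ∣ (2 * suc i + x) / suc i
even-floor-shift i x d = subst (2 ∣_) (sym (floor-shift i x)) (∣m∣n⇒∣m+n ∣-refl d)

even-floor-unshift : ∀ i x → 2 ∣ (2 * suc i + x) / suc i → 2 ∣ x / suc i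
even-floor-unshift i x d = ∣m+n∣m⇒∣n (subst (2 ∣_) (floor-shift i x) d) ∣-refl

even-floor-small : ∀ i x → x < suc i → 2 ∣ x / suc i
even-floor-small i x lt = subst (2 ∣_) (sym (m<n⇒m/n≡0 lt)) (divides 0 refl)

even-floor⇒small : ∀ i x → x < 2 * suc i → 2 ∣ x / suc i → x < suc i
even-floor⇒small i x lt d with suc i ≤? x
... | no i≰x = ≰⇒> i≰x
... | yes i≤x = ⊥-elim (2∤1 (subst (2 ∣_) floor≡1 d))
  where
  floor≡1 : x / suc i ≡ 1
  floor≡1 = ≤-antisym (≤-pred (m<n*o⇒m/o<n {x} {2} {suc i} lt))
                      (≤-trans (≤-reflexive (sym (n/n≡1 (suc i)))) (/-monoˡ-≤ (suc i) i≤x))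
  2∤1 : ¬ (2 ∣ 1)
  2∤1 h with ∣1⇒≡1 h
  ... | ()

alh-step⇒≥ : ∀ p x y → x < p → p * y ≤ suc p * x → y ≤ x
alh-step⇒≥ p x y x<p h with y ≤? x
... | yes y≤x = y≤x
... | no y≰x = ⊥-elim (<⇒≱ x<p p≤x)
  where
  p≤x : p ≤ x
  p≤x = +-cancelʳ-≤ (p * x) p x
          (≤-trans (≤-reflexive (sym (*-suc p x))) (≤-trans (*-monoʳ-≤ p (≰⇒> y≰x)) h))

≥⇒alh-step : ∀ p x y → y ≤ x → p * y ≤ suc p * x
≥⇒alh-step p x y y≤x = ≤-trans (*-monoʳ-≤ p y≤x) (*-monoˡ-≤ x (n≤1+n p))

-- The step is invariant under shifting μ_p by 2p and μ_{p+1} by 2(p+1),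
-- because p · 2(p+1) = (p+1) · 2p.
shift-lhs : ∀ p y → p * (2 * suc p + y) ≡ p * (2 * suc p) + p * y
shift-lhs = solve-∀

shift-rhs : ∀ p x → suc p * (2 * p + x) ≡ p * (2 * suc p) + suc p * x
shift-rhs = solve-∀

alh-step-shift : ∀ p x y → p * y ≤ suc p * x → p * (2 * suc p + y) ≤ suc p * (2 * p + x)
alh-step-shift p x y h = begin
  p * (2 * suc p + y)          ≡⟨ shift-lhs p y ⟩
  p * (2 * suc p) + p * y      ≤⟨ +-monoʳ-≤ (p * (2 * suc p)) h ⟩
  p * (2 * suc p) + suc p * x  ≡⟨ shift-rhs p x ⟨
  suc p * (2 * p + x)          ∎
  where open ≤-Reasoning

alh-step-unshift : ∀ p x y → 2 * p ≤ x → 2 * suc p ≤ y → p * y ≤ suc p * x →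
  p * (y ∸ 2 * suc p) ≤ suc p * (x ∸ 2 * p)
alh-step-unshift p x y 2p≤x 2p'≤y h = +-cancelˡ-≤ (p * (2 * suc p)) _ _ (begin
  p * (2 * suc p) + p * (y ∸ 2 * suc p)   ≡⟨ shift-lhs p (y ∸ 2 * suc p) ⟨
  p * (2 * suc p + (y ∸ 2 * suc p))       ≡⟨ cong (p *_) (m+[n∸m]≡n 2p'≤y) ⟩
  p * y                                   ≤⟨ h ⟩
  suc p * x                               ≡⟨ cong (suc p *_) (m+[n∸m]≡n 2p≤x) ⟨
  suc p * (2 * p + (x ∸ 2 * p))           ≡⟨ shift-rhs p (x ∸ 2 * p) ⟩
  p * (2 * suc p) + suc p * (x ∸ 2 * p)   ∎)
  where open ≤-Reasoning

alh-step-to-small : ∀ p x y → 2 * p ≤ x → y ≤ p → p * y ≤ suc p * x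
alh-step-to-small p x y 2p≤x y≤p =
  ≥⇒alh-step p x y (≤-trans y≤p (≤-trans (m≤m+n p (p + 0)) 2p≤x))

-- Segments of compositions.  Valid i xs: the list xs, placed at positions
-- i+1, i+2, …, satisfies both the anti-lecture hall and the parity conditions.

Valid : ℕ → List ℕ → Set
Valid i xs = ALHFrom (suc i) xs × EvenFloorFrom i xs

StepFrom : ℕ → ℕ → List ℕ → Set
StepFrom p x [] = ⊤
StepFrom p x (y ∷ _) = p * y ≤ suc p * x

alh-uncons : ∀ {p x xs} → ALHFrom p (x ∷ xs) → StepFrom p x xs × ALHFrom (suc p) xs
alh-uncons {xs = []} _ = tt , tt
alh-uncons {xs = y ∷ ys} (h , r) = h , r

alh-cons : ∀ {p x xs} → StepFrom p x xs → ALHFrom (suc p) xs → ALHFrom p (x ∷ xs)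
alh-cons {xs = []} _ _ = tt
alh-cons {xs = y ∷ ys} h r = h , r

after : ℕ → List ℕ → ℕ
after i [] = i
after i (_ ∷ xs) = after (suc i) xs

after-length : ∀ i xs → after i xs ≡ length xs + i
after-length i [] = refl
after-length i (x ∷ xs) = trans (after-length (suc i) xs) (+-suc (length xs) i)

after-0 : ∀ xs → after 0 xs ≡ length xs
after-0 xs = trans (after-length 0 xs) (+-identityʳ _)

Shifted : ℕ → List ℕ → Set
Shifted i [] = ⊤
Shifted i (x ∷ xs) = 2 * suc i ≤ x × Shifted (suc i) xs

SmallHead : ℕ → List ℕ → Set
SmallHead i [] = ⊤
SmallHead i (y ∷ _) = y < 2 * suc i

shift : ℕ → List ℕ → List ℕ
shift i [] = []
shift i (x ∷ xs) = (2 * suc i + x) ∷ shift (suc i) xs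

unshift : ℕ → List ℕ → List ℕ
unshift i [] = []
unshift i (x ∷ xs) = (x ∸ 2 * suc i) ∷ unshift (suc i) xs

splitShifted : ℕ → List ℕ → List ℕ × List ℕ
splitShifted i [] = [] , []
splitShifted i (x ∷ xs) with 2 * suc i ≤? x
... | yes _ = x ∷ proj₁ (splitShifted (suc i) xs) , proj₂ (splitShifted (suc i) xs)
... | no _ = [] , x ∷ xs

splitShifted-++ : ∀ i xs → proj₁ (splitShifted i xs) ++ proj₂ (splitShifted i xs) ≡ xs
splitShifted-++ i [] = refl
splitShifted-++ i (x ∷ xs) with 2 * suc i ≤? x
... | yes _ = cong (x ∷_) (splitShifted-++ (suc i) xs)
... | no _ = refl

splitShifted-shifted : ∀ i xs → Shifted i (proj₁ (splitShifted i xs))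
splitShifted-shifted i [] = tt
splitShifted-shifted i (x ∷ xs) with 2 * suc i ≤? x
... | yes p = p , splitShifted-shifted (suc i) xs
... | no _ = tt

splitShifted-small : ∀ i xs → SmallHead (after i (proj₁ (splitShifted i xs))) (proj₂ (splitShifted i xs))
splitShifted-small i [] = tt
splitShifted-small i (x ∷ xs) with 2 * suc i ≤? x
... | yes p = splitShifted-small (suc i) xs
... | no i≰x = ≰⇒> i≰x

splitShifted-unique : ∀ i a b → Shifted i a → SmallHead (after i a) b → splitShifted i (a ++ b) ≡ (a , b)
splitShifted-unique i [] [] _ _ = refl
splitShifted-unique i [] (y ∷ b) _ s with 2 * suc i ≤? y
... | yes p = ⊥-elim (<⇒≱ s p)
... | no _ = refl
splitShifted-unique i (x ∷ a) b (p , sa) s with 2 * suc i ≤? x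
... | yes _ rewrite splitShifted-unique (suc i) a b sa s = refl
... | no i≰x = ⊥-elim (i≰x p)

valid-split : ∀ i a b → Valid i (a ++ b) → Valid i a × Valid (after i a) b
valid-split i [] b v = (tt , tt) , v
valid-split i (x ∷ a) b (alh , (ev , evs)) with alh-uncons {xs = a ++ b} alh
... | h , alhs with valid-split (suc i) a b (alhs , evs)
... | (alha , eva) , vb = (alh-cons (step-prefix a h) alha , (ev , eva)) , vb
  where
  step-prefix : ∀ a → StepFrom (suc i) x (a ++ b) → StepFrom (suc i) x a
  step-prefix [] _ = tt
  step-prefix (y ∷ a) h = h

valid-join : ∀ i a b → Valid i a → Valid (after i a) b → Shifted i a → All (_≤ after i a) b → Valid i (a ++ b)
valid-join i [] b _ vb _ _ = vb
valid-join i (x ∷ a) b (alh , (ev , eva)) vb (2i≤x , sa) b≤ with alh-uncons {xs = a} alh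
... | h , alha with valid-join (suc i) a b (alha , eva) vb sa b≤
... | alh′ , ev′ = alh-cons (step-joined a h b≤) alh′ , (ev , ev′)
  where
  step-joined : ∀ a → StepFrom (suc i) x a → All (_≤ after (suc i) a) b → StepFrom (suc i) x (a ++ b)
  step-joined [] _ [] = tt
  step-joined [] _ (y≤ ∷ _) = alh-step-to-small (suc i) x _ 2i≤x y≤
  step-joined (y ∷ a) h _ = h

-- Shifting and unshifting preserve validity (floors change by 2, and the
-- anti-lecture hall steps are invariant).
valid-shift : ∀ i a → Valid i a → Valid i (shift i a)
valid-shift i [] v = v
valid-shift i (x ∷ a) (alh , (ev , eva)) with alh-uncons {xs = a} alh
... | h , alha with valid-shift (suc i) a (alha , eva)
... | alh′ , ev′ = alh-cons (step-shifted a h) alh′ , (even-floor-shift i x ev , ev′)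
  where
  step-shifted : ∀ a → StepFrom (suc i) x a → StepFrom (suc i) (2 * suc i + x) (shift (suc i) a)
  step-shifted [] _ = tt
  step-shifted (y ∷ a) h = alh-step-shift (suc i) x y h

valid-unshift : ∀ i a → Shifted i a → Valid i a → Valid i (unshift i a)
valid-unshift i [] _ v = v
valid-unshift i (x ∷ a) (2i≤x , sa) (alh , (ev , eva)) with alh-uncons {xs = a} alh
... | h , alha with valid-unshift (suc i) a sa (alha , eva)
... | alh′ , ev′ = alh-cons (step-unshifted a sa h) alh′ , (ev″ , ev′)
  where
  ev″ : 2 ∣ (x ∸ 2 * suc i) / suc i
  ev″ = even-floor-unshift i (x ∸ 2 * suc i) (subst (λ z → 2 ∣ z / suc i) (sym (m+[n∸m]≡n 2i≤x)) ev)
  step-unshifted : ∀ a → Shifted (suc i) a → StepFrom (suc i) x a →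
    StepFrom (suc i) (x ∸ 2 * suc i) (unshift (suc i) a)
  step-unshifted [] _ _ = tt
  step-unshifted (y ∷ a) (2i′≤y , _) h = alh-step-unshift (suc i) x y 2i≤x 2i′≤y h

shift-shifted : ∀ i a → Shifted i (shift i a)
shift-shifted i [] = tt
shift-shifted i (x ∷ a) = m≤m+n _ x , shift-shifted (suc i) a

unshift-shift : ∀ i a → unshift i (shift i a) ≡ a
unshift-shift i [] = refl
unshift-shift i (x ∷ a) = cong₂ _∷_ (m+n∸m≡n (2 * suc i) x) (unshift-shift (suc i) a)

shift-unshift : ∀ i a → Shifted i a → shift i (unshift i a) ≡ a
shift-unshift i [] _ = refl
shift-unshift i (x ∷ a) (2i≤x , sa) = cong₂ _∷_ (m+[n∸m]≡n 2i≤x) (shift-unshift (suc i) a sa)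

length-shift : ∀ i a → length (shift i a) ≡ length a
length-shift i [] = refl
length-shift i (x ∷ a) = cong suc (length-shift (suc i) a)

length-unshift : ∀ i a → length (unshift i a) ≡ length a
length-unshift i [] = refl
length-unshift i (x ∷ a) = cong suc (length-unshift (suc i) a)

after-shift : ∀ i a → after i (shift i a) ≡ after i a
after-shift i [] = refl
after-shift i (x ∷ a) = after-shift (suc i) a

-- Shifting positions 1..L adds 2(1 + … + L) = L (L+1) (here for a
-- segment starting at i+1).
sum-shift : ∀ i a → sum (shift i a) ≡ sum a + length a * (length a + 2 * i + 1)
sum-shift i [] = refl
sum-shift i (x ∷ a) = trans (cong (2 * suc i + x +_) (sum-shift (suc i) a)) (shift-identity i x (sum a) (length a))
  where
  shift-identity : ∀ i x s n → 2 * suc i + x + (s + n * (n + 2 * suc i + 1)) ≡ x + s + suc n * (suc n + 2 * i + 1)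
  shift-identity = solve-∀

-- A valid segment with small head, starting at position j+1, is a
-- partition with parts at most j: its entries stay below their positions.
smallTail⇒partition : ∀ j b → Valid j b → SmallHead j b → Decreasing b × All (_≤ j) b
smallTail⇒partition j [] _ _ = [] , []
smallTail⇒partition j (y ∷ b) (alh , (ev , evs)) small with alh-uncons {xs = b} alh
... | h , alhs = decreasing , (y≤j ∷ All.map (λ q → ≤-trans q y≤j) (decreasing⇒≤head decreasing))
  where
  y<j′ : y < suc j
  y<j′ = even-floor⇒small j y small ev
  y≤j : y ≤ j
  y≤j = ≤-pred y<j′
  next-small : ∀ b → StepFrom (suc j) y b → SmallHead (suc j) b
  next-small [] _ = tt
  next-small (y′ ∷ b) h = s≤s (≤-trans (alh-step⇒≥ (suc j) y y′ y<j′ h) (≤-trans y≤j (≤-trans (n≤1+n j) (m≤m+n (suc j) _))))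
  rest = smallTail⇒partition (suc j) b (alhs , evs) (next-small b h)
  cons-decreasing : ∀ b → StepFrom (suc j) y b → Decreasing b → Decreasing (y ∷ b)
  cons-decreasing [] _ _ = [-]
  cons-decreasing (y′ ∷ b) h d = alh-step⇒≥ (suc j) y y′ y<j′ h ∷ d
  decreasing : Decreasing (y ∷ b)
  decreasing = cons-decreasing b h (proj₁ rest)

partition⇒smallTail : ∀ j b → Decreasing b → All (_≤ j) b → Valid j b
partition⇒smallTail j [] _ _ = tt , tt
partition⇒smallTail j (y ∷ b) d (y≤j ∷ b≤) with partition⇒smallTail (suc j) b (Linked.tail d) (All.map (λ q → ≤-trans q (n≤1+n j)) b≤)
... | alh , ev = alh-cons (step-down b d) alh , (even-floor-small j y (s≤s y≤j) , ev)
  where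
  step-down : ∀ b → Decreasing (y ∷ b) → StepFrom (suc j) y b
  step-down [] _ = tt
  step-down (y′ ∷ b) (y≥y′ ∷ _) = ≥⇒alh-step (suc j) y y′ y≥y′

-- Conjugation of partitions, in two guises: 'conjugate e len' builds the
-- conjugate row by row (padded with zeros to length len ≥ e_1), while
-- 'columns L rs' reads off the first L column lengths of rs.

-- Remove the first column: decrement the positive prefix.
dropColumn : List ℕ → List ℕ
dropColumn [] = []
dropColumn (zero ∷ xs) = []
dropColumn (suc x ∷ xs) = x ∷ dropColumn xs

columns : ℕ → List ℕ → List ℕ
columns zero rs = []
columns (suc L) rs = length (dropColumn rs) ∷ columns L (dropColumn rs)

headOr0 : List ℕ → ℕ
headOr0 [] = 0
headOr0 (x ∷ _) = x

conjugate : List ℕ → ℕ → List ℕ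
conjugate [] len = replicate len 0
conjugate (e ∷ es) len = map suc (conjugate es e) ++ replicate (len ∸ e) 0

length-dropColumn : ∀ rs → length (dropColumn rs) ≤ length rs
length-dropColumn [] = z≤n
length-dropColumn (zero ∷ rs) = z≤n
length-dropColumn (suc x ∷ rs) = s≤s (length-dropColumn rs)

dropColumn-decreasing : ∀ rs → Decreasing rs → Decreasing (dropColumn rs)
dropColumn-decreasing [] _ = []
dropColumn-decreasing (zero ∷ rs) _ = []
dropColumn-decreasing (suc x ∷ []) _ = [-]
dropColumn-decreasing (suc x ∷ zero ∷ rs) _ = [-]
dropColumn-decreasing (suc x ∷ suc y ∷ rs) (p ∷ d) = ≤-pred p ∷ dropColumn-decreasing (suc y ∷ rs) d

dropColumn-bounded : ∀ L rs → All (_≤ suc L) rs → All (_≤ L) (dropColumn rs)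
dropColumn-bounded L [] _ = []
dropColumn-bounded L (zero ∷ rs) _ = []
dropColumn-bounded L (suc x ∷ rs) (p ∷ a) = ≤-pred p ∷ dropColumn-bounded L rs a

zeros-decreasing : ∀ n → Decreasing (replicate n 0)
zeros-decreasing zero = []
zeros-decreasing (suc zero) = [-]
zeros-decreasing (suc (suc n)) = z≤n ∷ zeros-decreasing (suc n)

all-zero : ∀ rs → All (_≤ 0) rs → rs ≡ replicate (length rs) 0
all-zero [] _ = refl
all-zero (x ∷ rs) (z≤n ∷ a) = cong (0 ∷_) (all-zero rs a)

sum-zeros : ∀ n → sum (replicate n 0) ≡ 0
sum-zeros zero = refl
sum-zeros (suc n) = sum-zeros n

dropColumn-restore : ∀ rs → Decreasing rs → map suc (dropColumn rs) ++ replicate (length rs ∸ length (dropColumn rs)) 0 ≡ rs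
dropColumn-restore [] _ = refl
dropColumn-restore (zero ∷ rs) d = cong (0 ∷_) (sym (all-zero rs (decreasing⇒≤head d)))
dropColumn-restore (suc x ∷ rs) d = cong (suc x ∷_) (dropColumn-restore rs (Linked.tail d))

dropColumn-conjugate : ∀ xs n → dropColumn (map suc xs ++ replicate n 0) ≡ xs
dropColumn-conjugate [] zero = refl
dropColumn-conjugate [] (suc n) = refl
dropColumn-conjugate (x ∷ xs) n = cong (x ∷_) (dropColumn-conjugate xs n)

length-dropColumn-positive : ∀ b → All (1 ≤_) b → length (dropColumn b) ≡ length b
length-dropColumn-positive [] _ = refl
length-dropColumn-positive (suc x ∷ b) (_ ∷ a) = cong suc (length-dropColumn-positive b a)

length-conjugate : ∀ e len → Decreasing e → All (_≤ len) e → length (conjugate e len) ≡ len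
length-conjugate [] len _ _ = length-replicate len
length-conjugate (e ∷ es) len d (e≤len ∷ _) = begin
  length (map suc (conjugate es e) ++ replicate (len ∸ e) 0)
    ≡⟨ length-++ (map suc (conjugate es e)) ⟩
  length (map suc (conjugate es e)) + length (replicate (len ∸ e) 0)
    ≡⟨ cong₂ _+_ (trans (length-map suc (conjugate es e)) (length-conjugate es e (Linked.tail d) (decreasing⇒≤head d)))
                 (length-replicate (len ∸ e)) ⟩
  e + (len ∸ e)
    ≡⟨ m+[n∸m]≡n e≤len ⟩
  len ∎
  where open ≡-Reasoning

columns-conjugate : ∀ e len → Decreasing e → columns (length e) (conjugate e len) ≡ e
columns-conjugate [] len _ = refl
columns-conjugate (e ∷ es) len d rewrite dropColumn-conjugate (conjugate es e) (len ∸ e) =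
  cong₂ _∷_ (length-conjugate es e (Linked.tail d) (decreasing⇒≤head d))
            (columns-conjugate es e (Linked.tail d))

conjugate-columns : ∀ L rs → Decreasing rs → All (_≤ L) rs → conjugate (columns L rs) (length rs) ≡ rs
conjugate-columns zero rs d a = sym (all-zero rs a)
conjugate-columns (suc L) rs d a
  rewrite conjugate-columns L (dropColumn rs) (dropColumn-decreasing rs d) (dropColumn-bounded L rs a) =
  dropColumn-restore rs d

length-columns : ∀ L rs → length (columns L rs) ≡ L
length-columns zero rs = refl
length-columns (suc L) rs = cong suc (length-columns L (dropColumn rs))

columns-decreasing : ∀ L rs → Decreasing (columns L rs)
columns-decreasing zero rs = []
columns-decreasing (suc zero) rs = [-]
columns-decreasing (suc (suc L)) rs = length-dropColumn (dropColumn rs) ∷ columns-decreasing (suc L) (dropColumn rs)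

columns-bounded : ∀ L rs → All (_≤ length rs) (columns L rs)
columns-bounded zero rs = []
columns-bounded (suc L) rs =
  length-dropColumn rs ∷ All.map (λ q → ≤-trans q (length-dropColumn rs)) (columns-bounded L (dropColumn rs))

conjugate-decreasing : ∀ e len → Decreasing e → Decreasing (conjugate e len)
conjugate-decreasing [] len _ = zeros-decreasing len
conjugate-decreasing (e ∷ es) len d =
  decreasing-++ {c = 0}
    (decreasing-map suc s≤s (conjugate-decreasing es e (Linked.tail d)))
    (zeros-decreasing (len ∸ e))
    (All.tabulate (λ _ → z≤n)) (replicate⁺ (len ∸ e) z≤n)

conjugate-bounded : ∀ e len → Decreasing e → All (_≤ length e) (conjugate e len)
conjugate-bounded [] len _ = replicate⁺ len z≤n
conjugate-bounded (e ∷ es) len d =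
  ++⁺ (map⁺ (All.map s≤s (conjugate-bounded es e (Linked.tail d)))) (replicate⁺ (len ∸ e) z≤n)

conjugate-positive : ∀ e → All (1 ≤_) (conjugate e (headOr0 e))
conjugate-positive [] = []
conjugate-positive (e ∷ es) rewrite n∸n≡0 e = ++⁺ (map⁺ (All.tabulate (λ _ → s≤s z≤n))) []

sum-map-suc : ∀ xs → sum (map suc xs) ≡ length xs + sum xs
sum-map-suc [] = refl
sum-map-suc (x ∷ xs) = trans (cong (suc x +_) (sum-map-suc xs)) (cong suc (swap x (length xs) (sum xs)))
  where
  swap : ∀ a b c → a + (b + c) ≡ b + (a + c)
  swap = solve-∀

sum-conjugate : ∀ e len → Decreasing e → sum (conjugate e len) ≡ sum e
sum-conjugate [] len _ = sum-zeros len
sum-conjugate (e ∷ es) len d = begin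
  sum (map suc (conjugate es e) ++ replicate (len ∸ e) 0)
    ≡⟨ sum-++ (map suc (conjugate es e)) _ ⟩
  sum (map suc (conjugate es e)) + sum (replicate (len ∸ e) 0)
    ≡⟨ cong₂ _+_ (sum-map-suc (conjugate es e)) (sum-zeros (len ∸ e)) ⟩
  length (conjugate es e) + sum (conjugate es e) + 0
    ≡⟨ +-identityʳ _ ⟩
  length (conjugate es e) + sum (conjugate es e)
    ≡⟨ cong₂ _+_ (length-conjugate es e (Linked.tail d) (decreasing⇒≤head d))
                 (sum-conjugate es e (Linked.tail d)) ⟩
  e + sum es ∎
  where open ≡-Reasoning

stackBlock : List ℕ → List ℕ → ℕ → List ℕ
stackBlock q e len = shift 0 q ++ conjugate e len

compositionBelow : ℕ → List Block → List ℕ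
compositionBelow ℓ [] = replicate ℓ 0
compositionBelow ℓ ((L , e) ∷ bs) = stackBlock (compositionBelow L bs) e (ℓ ∸ L)

-- The composition of a chain: no padding after the first block.
toComposition : List Block → List ℕ
toComposition [] = []
toComposition ((L , e) ∷ bs) = stackBlock (compositionBelow L bs) e (headOr0 e)

-- Read off blocks: the maximal shifted prefix is the rectangle part, the
-- remaining small tail is the conjugate of e.
mutual
  blocksOf : ℕ → List ℕ → List Block
  blocksOf zero xs = []
  blocksOf (suc j) xs = blocksOfSplit j (splitShifted 0 xs)

  blocksOfSplit : ℕ → List ℕ × List ℕ → List Block
  blocksOfSplit j ([] , b) = []
  blocksOfSplit j (a@(_ ∷ _) , b) = (length a , columns (length a) b) ∷ blocksOf j (unshift 0 a)

blocksOfSplit-nonempty : ∀ j a b → 1 ≤ length a →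
  blocksOfSplit j (a , b) ≡ (length a , columns (length a) b) ∷ blocksOf j (unshift 0 a)
blocksOfSplit-nonempty j (x ∷ a) b _ = refl

PaddedComposition : ℕ → ℕ → List ℕ → Set
PaddedComposition j ℓ xs = length xs ≡ ℓ × Valid 0 xs × FirstAtMost (2 * j) xs

Composition : ℕ → List ℕ → Set
Composition j xs = LastNonZero xs × Valid 0 xs × FirstAtMost (2 * suc j) xs

bounded⇒smallHead : ∀ c t → All (_≤ c) t → SmallHead c t
bounded⇒smallHead c [] _ = tt
bounded⇒smallHead c (y ∷ t) (p ∷ _) = s≤s (≤-trans p (m≤m+n c _))

firstAtMost0⇒smallHead : ∀ xs → FirstAtMost 0 xs → SmallHead 0 xs
firstAtMost0⇒smallHead [] _ = tt
firstAtMost0⇒smallHead (x ∷ xs) z≤n = s≤s z≤n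

firstAtMost-zeros : ∀ m ℓ → FirstAtMost m (replicate ℓ 0)
firstAtMost-zeros m zero = tt
firstAtMost-zeros m (suc ℓ) = z≤n

firstAtMost-unshift : ∀ j x a → FirstAtMost (2 * suc j) (x ∷ a) → FirstAtMost (2 * j) (unshift 0 (x ∷ a))
firstAtMost-unshift j x a f = ≤-trans (∸-monoˡ-≤ 2 f) (≤-reflexive (trans (cong (_∸ 2) (*-suc 2 j)) (m+n∸m≡n 2 (2 * j))))

firstAtMost-stackBlock : ∀ j q e len L → length q ≡ L → 1 ≤ L → FirstAtMost (2 * j) q →
  FirstAtMost (2 * suc j) (stackBlock q e len)
firstAtMost-stackBlock j [] e len L refl () f
firstAtMost-stackBlock j (x ∷ q) e len L _ _ f = ≤-trans (+-monoʳ-≤ 2 f) (≤-reflexive (sym (*-suc 2 j)))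

shifted-positive : ∀ i a → Shifted i a → All (1 ≤_) a
shifted-positive i [] _ = []
shifted-positive i (x ∷ a) (2i≤x , sa) = ≤-trans (s≤s z≤n) 2i≤x ∷ shifted-positive (suc i) a sa

positive⇒lastNonZero : ∀ xs → All (1 ≤_) xs → LastNonZero xs
positive⇒lastNonZero [] _ = nil
positive⇒lastNonZero (x ∷ []) (p ∷ _) = one p
positive⇒lastNonZero (x ∷ y ∷ xs) (_ ∷ a) = cons (positive⇒lastNonZero (y ∷ xs) a)

alh-step-positive : ∀ p x y → 1 ≤ y → suc p * y ≤ suc (suc p) * x → 1 ≤ x
alh-step-positive p (suc x) y _ _ = s≤s z≤n
alh-step-positive p zero y 1≤y h =
  ⊥-elim (<⇒≱ (≤-trans (s≤s z≤n) (*-monoʳ-≤ (suc p) 1≤y)) (≤-trans h (≤-reflexive (*-zeroʳ (suc (suc p))))))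

lastNonZero-positive : ∀ p xs → LastNonZero xs → ALHFrom (suc p) xs → All (1 ≤_) xs
lastNonZero-positive p [] _ _ = []
lastNonZero-positive p (x ∷ []) (one q) _ = q ∷ []
lastNonZero-positive p (x ∷ y ∷ xs) (cons l) (h , r) with lastNonZero-positive (suc p) (y ∷ xs) l r
... | 1≤y ∷ a = alh-step-positive p x y 1≤y h ∷ 1≤y ∷ a

lastNonZero-zeros : ∀ xs → LastNonZero xs → All (_≤ 0) xs → xs ≡ []
lastNonZero-zeros [] _ _ = refl
lastNonZero-zeros (x ∷ []) (one q) (p ∷ _) = ⊥-elim (<⇒≱ q p)
lastNonZero-zeros (x ∷ y ∷ xs) (cons l) (_ ∷ a) with lastNonZero-zeros (y ∷ xs) l a
... | ()

conjugate-fits : ∀ q L e len → length q ≡ L → length e ≡ L → Decreasing e →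
  All (_≤ after 0 (shift 0 q)) (conjugate e len)
conjugate-fits q L e len lq le de =
  subst (λ c → All (_≤ c) (conjugate e len))
        (trans le (sym (trans (after-shift 0 q) (trans (after-0 q) lq))))
        (conjugate-bounded e len de)

stackBlock-valid : ∀ q L e len → length q ≡ L → length e ≡ L → Decreasing e → Valid 0 q →
  Valid 0 (stackBlock q e len)
stackBlock-valid q L e len lq le de vq =
  valid-join 0 (shift 0 q) (conjugate e len) (valid-shift 0 q vq)
    (partition⇒smallTail _ (conjugate e len) (conjugate-decreasing e len de) fits)
    (shift-shifted 0 q) fits
  where
  fits = conjugate-fits q L e len lq le de

sum-stackBlock : ∀ q L e len → length q ≡ L → length e ≡ L → Decreasing e →
  sum (stackBlock q e len) ≡ L * suc L + sum e + sum q
sum-stackBlock q L e len lq le de = begin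
  sum (shift 0 q ++ conjugate e len)                ≡⟨ sum-++ (shift 0 q) _ ⟩
  sum (shift 0 q) + sum (conjugate e len)           ≡⟨ cong₂ _+_ (sum-shift 0 q) (sum-conjugate e len de) ⟩
  sum q + length q * (length q + 2 * 0 + 1) + sum e ≡⟨ cong (λ n → sum q + n * (n + 2 * 0 + 1) + sum e) lq ⟩
  sum q + L * (L + 2 * 0 + 1) + sum e               ≡⟨ rearrange (sum q) L (sum e) ⟩
  L * suc L + sum e + sum q                         ∎
  where
  open ≡-Reasoning
  rearrange : ∀ w L s → w + L * (L + 2 * 0 + 1) + s ≡ L * suc L + s + w
  rearrange = solve-∀

blocksOf-stackBlock : ∀ j q L e len → length q ≡ L → 1 ≤ L → length e ≡ L → Decreasing e →
  blocksOf (suc j) (stackBlock q e len) ≡ (L , e) ∷ blocksOf j q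
blocksOf-stackBlock j q L e len lq 1≤L le de = begin
  blocksOfSplit j (splitShifted 0 (shift 0 q ++ conjugate e len))
    ≡⟨ cong (blocksOfSplit j) (splitShifted-unique 0 (shift 0 q) (conjugate e len) (shift-shifted 0 q)
                                 (bounded⇒smallHead _ _ (conjugate-fits q L e len lq le de))) ⟩
  blocksOfSplit j (shift 0 q , conjugate e len)
    ≡⟨ blocksOfSplit-nonempty j (shift 0 q) (conjugate e len) (≤-trans 1≤L (≤-reflexive (sym length-q′))) ⟩
  (length (shift 0 q) , columns (length (shift 0 q)) (conjugate e len)) ∷ blocksOf j (unshift 0 (shift 0 q))
    ≡⟨ cong₂ _∷_ (cong₂ _,_ length-q′ (trans (cong (λ n → columns n (conjugate e len)) (trans length-q′ (sym le)))
                                              (columns-conjugate e len de)))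
                 (cong (blocksOf j) (unshift-shift 0 q)) ⟩
  (L , e) ∷ blocksOf j q ∎
  where
  open ≡-Reasoning
  length-q′ : length (shift 0 q) ≡ L
  length-q′ = trans (length-shift 0 q) lq

length-prefix : ∀ (a b : List ℕ) ℓ → length (a ++ b) ≡ ℓ → length a ≤ ℓ
length-prefix a b ℓ eq = ≤-trans (m≤m+n (length a) (length b)) (≤-reflexive (trans (sym (length-++ a)) eq))

length-suffix : ∀ (a b : List ℕ) ℓ → length (a ++ b) ≡ ℓ → length b ≡ ℓ ∸ length a
length-suffix a b ℓ eq = trans (sym (m+n∸m≡n (length a) (length b))) (cong (_∸ length a) (trans (sym (length-++ a)) eq))

boundedChain⇒padded : ∀ j ℓ bs → BoundedChain j ℓ bs → PaddedComposition j ℓ (compositionBelow ℓ bs)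
boundedChain⇒padded j ℓ [] _ =
  length-replicate ℓ ,
  partition⇒smallTail 0 (replicate ℓ 0) (zeros-decreasing ℓ) (replicate⁺ ℓ z≤n) ,
  firstAtMost-zeros (2 * j) ℓ
boundedChain⇒padded (suc j) ℓ ((L , e) ∷ bs) (1≤L , L≤ℓ , le , de , e≤ , c) with boundedChain⇒padded j L bs c
... | lq , vq , fq =
  trans (length-++ (shift 0 q)) (trans (cong₂ _+_ (trans (length-shift 0 q) lq) (length-conjugate e (ℓ ∸ L) de e≤))
                                       (m+[n∸m]≡n L≤ℓ)) ,
  stackBlock-valid q L e (ℓ ∸ L) lq le de vq ,
  firstAtMost-stackBlock j q e (ℓ ∸ L) L lq 1≤L fq
  where q = compositionBelow L bs

chain⇒composition : ∀ j bs → Chain j bs → Composition j (toComposition bs)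
chain⇒composition j [] _ = nil , (tt , tt) , tt
chain⇒composition j ((L , e) ∷ bs) (1≤L , le , de , c) with boundedChain⇒padded j L bs c
... | lq , vq , fq =
  positive⇒lastNonZero _ (++⁺ (shifted-positive 0 _ (shift-shifted 0 q)) (conjugate-positive e)) ,
  stackBlock-valid q L e (headOr0 e) lq le de vq ,
  firstAtMost-stackBlock j q e (headOr0 e) L lq 1≤L fq
  where q = compositionBelow L bs

decompose-prefix : ∀ j x a b → Valid 0 ((x ∷ a) ++ b) → FirstAtMost (2 * suc j) ((x ∷ a) ++ b) →
  Shifted 0 (x ∷ a) → SmallHead (after 0 (x ∷ a)) b →
  PaddedComposition j (length (x ∷ a)) (unshift 0 (x ∷ a)) × Decreasing b × All (_≤ length (x ∷ a)) b
decompose-prefix j x a b v f sa small with valid-split 0 (x ∷ a) b v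
... | va , vb with smallTail⇒partition (after 0 (x ∷ a)) b vb small
... | db , b≤ =
  (length-unshift 0 (x ∷ a) , valid-unshift 0 (x ∷ a) sa va , firstAtMost-unshift j x a f) ,
  db , subst (λ c → All (_≤ c) b) (after-0 (x ∷ a)) b≤

noPrefix-zeros : ∀ xs → Valid 0 xs → SmallHead 0 xs → All (_≤ 0) xs
noPrefix-zeros xs v small = proj₂ (smallTail⇒partition 0 xs v small)

padded⇒boundedChain : ∀ j ℓ xs → PaddedComposition j ℓ xs → BoundedChain j ℓ (blocksOf j xs)
padded⇒boundedChain zero ℓ xs _ = tt
padded⇒boundedChain (suc j) ℓ xs p
  with splitShifted 0 xs | splitShifted-++ 0 xs | splitShifted-shifted 0 xs | splitShifted-small 0 xs
... | [] , b | _ | _ | _ = tt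
... | x ∷ a , b | refl | sa | small with p
... | lx , v , f with decompose-prefix j x a b v f sa small
... | p′ , db , b≤ =
  s≤s z≤n , length-prefix (x ∷ a) b ℓ lx , length-columns (length (x ∷ a)) b , columns-decreasing (length (x ∷ a)) b ,
  subst (λ c → All (_≤ c) (columns (length (x ∷ a)) b)) (length-suffix (x ∷ a) b ℓ lx) (columns-bounded (length (x ∷ a)) b) ,
  padded⇒boundedChain j (length (x ∷ a)) (unshift 0 (x ∷ a)) p′

composition⇒chain : ∀ j xs → Composition j xs → Chain j (blocksOf (suc j) xs)
composition⇒chain j xs p
  with splitShifted 0 xs | splitShifted-++ 0 xs | splitShifted-shifted 0 xs | splitShifted-small 0 xs
... | [] , b | _ | _ | _ = tt
... | x ∷ a , b | refl | sa | small with p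
... | _ , v , f with decompose-prefix j x a b v f sa small
... | p′ , _ , _ =
  s≤s z≤n , length-columns (length (x ∷ a)) b , columns-decreasing (length (x ∷ a)) b ,
  padded⇒boundedChain j (length (x ∷ a)) (unshift 0 (x ∷ a)) p′

blocksOf-compositionBelow : ∀ j ℓ bs → BoundedChain j ℓ bs → blocksOf j (compositionBelow ℓ bs) ≡ bs
blocksOf-compositionBelow zero ℓ [] _ = refl
blocksOf-compositionBelow (suc j) ℓ [] _ =
  cong (blocksOfSplit j) (splitShifted-unique 0 [] (replicate ℓ 0) tt
                           (firstAtMost0⇒smallHead _ (firstAtMost-zeros 0 ℓ)))
blocksOf-compositionBelow (suc j) ℓ ((L , e) ∷ bs) (1≤L , _ , le , de , _ , c) with boundedChain⇒padded j L bs c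
... | lq , _ , _ = trans (blocksOf-stackBlock j (compositionBelow L bs) L e (ℓ ∸ L) lq 1≤L le de)
                         (cong ((L , e) ∷_) (blocksOf-compositionBelow j L bs c))

blocksOf-toComposition : ∀ j bs → Chain j bs → blocksOf (suc j) (toComposition bs) ≡ bs
blocksOf-toComposition j [] _ = refl
blocksOf-toComposition j ((L , e) ∷ bs) (1≤L , le , de , c) with boundedChain⇒padded j L bs c
... | lq , _ , _ = trans (blocksOf-stackBlock j (compositionBelow L bs) L e (headOr0 e) lq 1≤L le de)
                         (cong ((L , e) ∷_) (blocksOf-compositionBelow j L bs c))

compositionBelow-blocksOf : ∀ j ℓ xs → PaddedComposition j ℓ xs → compositionBelow ℓ (blocksOf j xs) ≡ xs
compositionBelow-blocksOf zero ℓ xs (refl , v , f) =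
  sym (all-zero xs (noPrefix-zeros xs v (firstAtMost0⇒smallHead xs f)))
compositionBelow-blocksOf (suc j) ℓ xs p
  with splitShifted 0 xs | splitShifted-++ 0 xs | splitShifted-shifted 0 xs | splitShifted-small 0 xs
... | [] , b | refl | _ | small with p
... | refl , v , _ = sym (all-zero b (noPrefix-zeros b v small))
compositionBelow-blocksOf (suc j) ℓ xs p | x ∷ a , b | refl | sa | small with p
... | lx , v , f with decompose-prefix j x a b v f sa small
... | p′ , db , b≤ = cong₂ _++_
  (trans (cong (shift 0) (compositionBelow-blocksOf j (length (x ∷ a)) (unshift 0 (x ∷ a)) p′))
         (shift-unshift 0 (x ∷ a) sa))
  (trans (cong (conjugate (columns (length (x ∷ a)) b)) (sym (length-suffix (x ∷ a) b ℓ lx)))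
         (conjugate-columns (length (x ∷ a)) b db b≤))

toComposition-blocksOf : ∀ j xs → Composition j xs → toComposition (blocksOf (suc j) xs) ≡ xs
toComposition-blocksOf j xs p
  with splitShifted 0 xs | splitShifted-++ 0 xs | splitShifted-shifted 0 xs | splitShifted-small 0 xs
... | [] , b | refl | _ | small with p
... | lz , v , _ = sym (lastNonZero-zeros b lz (noPrefix-zeros b v small))
toComposition-blocksOf j xs p | x ∷ a , b | refl | sa | small with p
... | lz , v , f with decompose-prefix j x a b v f sa small
... | p′ , db , b≤ = cong₂ _++_
  (trans (cong (shift 0) (compositionBelow-blocksOf j (length (x ∷ a)) (unshift 0 (x ∷ a)) p′))
         (shift-unshift 0 (x ∷ a) sa))
  (trans (cong (conjugate (columns (length (x ∷ a)) b)) (length-dropColumn-positive b b-positive))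
         (conjugate-columns (length (x ∷ a)) b db b≤))
  where
  b-positive : All (1 ≤_) b
  b-positive = ++⁻ʳ (x ∷ a) (lastNonZero-positive 0 ((x ∷ a) ++ b) lz (proj₁ v))

sum-compositionBelow : ∀ j ℓ bs → BoundedChain j ℓ bs → sum (compositionBelow ℓ bs) ≡ weight bs
sum-compositionBelow j ℓ [] _ = sum-zeros ℓ
sum-compositionBelow (suc j) ℓ ((L , e) ∷ bs) (_ , _ , le , de , _ , c) with boundedChain⇒padded j L bs c
... | lq , _ , _ = trans (sum-stackBlock (compositionBelow L bs) L e (ℓ ∸ L) lq le de)
                         (cong (L * suc L + sum e +_) (sum-compositionBelow j L bs c))

sum-toComposition : ∀ j bs → Chain j bs → sum (toComposition bs) ≡ weight bs
sum-toComposition j [] _ = refl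
sum-toComposition j ((L , e) ∷ bs) (_ , le , de , c) with boundedChain⇒padded j L bs c
... | lq , _ , _ = trans (sum-stackBlock (compositionBelow L bs) L e (headOr0 e) lq le de)
                         (cong (L * suc L + sum e +_) (sum-compositionBelow j L bs c))

-- Proof irrelevance of all validity predicates involved, so that elements
-- of the subtypes are determined by their underlying lists.

×-irrelevant : ∀ {A B : Set} → Irrelevant A → Irrelevant B → Irrelevant (A × B)
×-irrelevant irrA irrB (a , b) (a′ , b′) = cong₂ _,_ (irrA a a′) (irrB b b′)

decreasing-irrelevant : ∀ {xs} → Irrelevant (Decreasing xs)
decreasing-irrelevant = Linked.irrelevant ≤-irrelevant

boundedChain-irrelevant : ∀ j B bs → Irrelevant (BoundedChain j B bs)
boundedChain-irrelevant j B [] = ⊤-irrelevant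
boundedChain-irrelevant (suc j) B ((L , e) ∷ bs) =
  ×-irrelevant ≤-irrelevant (×-irrelevant ≤-irrelevant (×-irrelevant ≡-irrelevant (×-irrelevant decreasing-irrelevant
    (×-irrelevant (All.irrelevant ≤-irrelevant) (boundedChain-irrelevant j L bs)))))

chain-irrelevant : ∀ j bs → Irrelevant (Chain j bs)
chain-irrelevant j [] = ⊤-irrelevant
chain-irrelevant j ((L , e) ∷ bs) =
  ×-irrelevant ≤-irrelevant (×-irrelevant ≡-irrelevant (×-irrelevant decreasing-irrelevant (boundedChain-irrelevant j L bs)))

fitsIn-irrelevant : ∀ {j xs} → Irrelevant (FitsIn j xs)
fitsIn-irrelevant done done = refl
fitsIn-irrelevant (step xs a f) (step .xs a′ f′) = cong₂ (step xs) (≤-irrelevant a a′) (fitsIn-irrelevant f f′)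

lastNonZero-irrelevant : ∀ {xs} → Irrelevant (LastNonZero xs)
lastNonZero-irrelevant nil nil = refl
lastNonZero-irrelevant (one a) (one b) = cong one (≤-irrelevant a b)
lastNonZero-irrelevant (cons a) (cons b) = cong cons (lastNonZero-irrelevant a b)

alh-irrelevant : ∀ p xs → Irrelevant (ALHFrom p xs)
alh-irrelevant p [] = ⊤-irrelevant
alh-irrelevant p (x ∷ []) = ⊤-irrelevant
alh-irrelevant p (x ∷ y ∷ ys) = ×-irrelevant ≤-irrelevant (alh-irrelevant (suc p) (y ∷ ys))

2∣-irrelevant : ∀ {x} → Irrelevant (2 ∣ x)
2∣-irrelevant (divides q e) (divides q′ e′) with *-cancelʳ-≡ q q′ 2 (trans (sym e) e′)
... | refl = cong (divides q) (≡-irrelevant e e′)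

evenFloor-irrelevant : ∀ i xs → Irrelevant (EvenFloorFrom i xs)
evenFloor-irrelevant i [] = ⊤-irrelevant
evenFloor-irrelevant i (x ∷ xs) = ×-irrelevant 2∣-irrelevant (evenFloor-irrelevant (suc i) xs)

firstAtMost-irrelevant : ∀ m xs → Irrelevant (FirstAtMost m xs)
firstAtMost-irrelevant m [] = ⊤-irrelevant
firstAtMost-irrelevant m (x ∷ xs) = ≤-irrelevant

subset-↔ : ∀ {A B : Set} {P : A → Set} {P′ : B → Set} →
  (∀ a → Irrelevant (P a)) → (∀ b → Irrelevant (P′ b)) →
  (f : A → B) (g : B → A) → (∀ {a} → P a → P′ (f a)) → (∀ {b} → P′ b → P (g b)) →
  (∀ {a} → P a → g (f a) ≡ a) → (∀ {b} → P′ b → f (g b) ≡ b) →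
  Σ A P ↔ Σ B P′
subset-↔ {P = P} {P′} irrP irrP′ f g f-valid g-valid g∘f f∘g =
  mk↔ₛ′ (λ (a , p) → f a , f-valid p) (λ (b , q) → g b , g-valid q)
        (λ (b , q) → Σ-≡ irrP′ (f∘g q)) (λ (a , p) → Σ-≡ irrP (g∘f p))
  where
  Σ-≡ : ∀ {C : Set} {Q : C → Set} → (∀ c → Irrelevant (Q c)) →
    ∀ {c c′ : C} {q : Q c} {q′ : Q c′} → c ≡ c′ → _≡_ {A = Σ C Q} (c , q) (c′ , q′)
  Σ-≡ irr {c} {q = q} {q′} refl = cong (c ,_) (irr c q q′)

Chains : ℕ → ℕ → Set
Chains j n = Σ (List Block) λ bs → Chain j bs × weight bs ≡ n

chains-irrelevant : ∀ j n bs → Irrelevant (Chain j bs × weight bs ≡ n)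
chains-irrelevant j n bs = ×-irrelevant (chain-irrelevant j bs) ≡-irrelevant

partitions↔chains : ∀ j n → R (suc (suc j)) n ↔ Chains j n
partitions↔chains j n =
  subset-↔ (λ xs → ×-irrelevant (×-irrelevant decreasing-irrelevant (×-irrelevant (All.irrelevant ≤-irrelevant) ≡-irrelevant))
                                 (×-irrelevant (All.irrelevant ≤-irrelevant) fitsIn-irrelevant))
           (chains-irrelevant j n)
           (durfeeBlocks (suc j)) toPartition to-valid from-valid
           (λ ((d , _ , _) , _ , f) → toPartition-durfeeBlocks (suc j) _ f d)
           (λ (c , _) → durfeeBlocks-toPartition j _ c)
  where
  to-valid : ∀ {xs} → IsPartition n xs × All (2 ≤_) xs × FitsIn (suc j) xs →
    Chain j (durfeeBlocks (suc j) xs) × weight (durfeeBlocks (suc j) xs) ≡ n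
  to-valid {xs} ((d , _ , s) , _ , f) =
    c , trans (sym (sum-toPartition _ (chain-lengths j _ c))) (trans (cong sum (toPartition-durfeeBlocks (suc j) xs f d)) s)
    where c = partition⇒chain j xs d f
  from-valid : ∀ {bs} → Chain j bs × weight bs ≡ n →
    IsPartition n (toPartition bs) × All (2 ≤_) (toPartition bs) × FitsIn (suc j) (toPartition bs)
  from-valid {bs} (c , w) with chain⇒partition j bs c
  ... | d , f , big = (d , All.map (≤-trans (s≤s z≤n)) big , trans (sum-toPartition bs (chain-lengths j bs c)) w) , big , f

compositions↔chains : ∀ j n → Q (2 * suc j) n ↔ Chains j n
compositions↔chains j n =
  subset-↔ (λ μ → ×-irrelevant lastNonZero-irrelevant (×-irrelevant ≡-irrelevant (×-irrelevant (alh-irrelevant 1 μ)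
                     (×-irrelevant (evenFloor-irrelevant 0 μ) (firstAtMost-irrelevant (2 * suc j) μ)))))
           (chains-irrelevant j n)
           (blocksOf (suc j)) toComposition to-valid from-valid
           (λ (l , _ , alh , ev , fam) → toComposition-blocksOf j _ (l , (alh , ev) , fam))
           (λ (c , _) → blocksOf-toComposition j _ c)
  where
  to-valid : ∀ {μ} → LastNonZero μ × sum μ ≡ n × ALHFrom 1 μ × EvenFloorFrom 0 μ × FirstAtMost (2 * suc j) μ →
    Chain j (blocksOf (suc j) μ) × weight (blocksOf (suc j) μ) ≡ n
  to-valid {μ} (l , s , alh , ev , fam) =
    c , trans (sym (sum-toComposition j _ c)) (trans (cong sum (toComposition-blocksOf j μ comp)) s)
    where
    comp = l , (alh , ev) , fam
    c = composition⇒chain j μ comp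
  from-valid : ∀ {bs} → Chain j bs × weight bs ≡ n →
    LastNonZero (toComposition bs) × sum (toComposition bs) ≡ n × ALHFrom 1 (toComposition bs) ×
    EvenFloorFrom 0 (toComposition bs) × FirstAtMost (2 * suc j) (toComposition bs)
  from-valid {bs} (c , w) with chain⇒composition j bs c
  ... | l , (alh , ev) , fam = l , trans (sum-toComposition j bs c) w , alh , ev , fam

theorem4p3 : (k n : ℕ) → 2 ≤ k → R k n ⤖ Q (2 * k ∸ 2) n
theorem4p3 (suc zero) n (s≤s ())
theorem4p3 (suc (suc j)) n _ =
  subst (λ m → R (suc (suc j)) n ⤖ Q m n) (sym bound)
        (↔⇒⤖ (↔-trans (partitions↔chains j n) (↔-sym (compositions↔chains j n))))
  where
  bound : 2 * suc (suc j) ∸ 2 ≡ 2 * suc j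
  bound = trans (cong (_∸ 2) (*-suc 2 (suc j))) (m+n∸m≡n 2 (2 * suc j))
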